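{- Any monomorphism $f:P\to Q$ in $\mathbf{rPres}$ is a cofibration, i.e. has the left lifting property with respect to every morphism having the right lifting property with respect to all morphisms of $\mathcal{I}$; in fact it is an $\mathcal{I}$-cellular extension.
   Context: We work in the category $\mathbf{rPres}$ of reflexive presentations of monoids (generators $P_1$, relations $P_2\subseteq P_1^*\times P_1^*$ containing $u\to u$ for all words $u$; morphisms are maps on generators sending relations to relations); monomorphisms are morphisms injective on generators. Let $G$ be the presentation with one generator and no relation, $G^n$ the one with $n$ generators $a_1,\dots,a_n$ and no relation, and $R^{m,n}$ the one with generators $a_1,\dots,a_{m+n}$ and the relation $a_1\cdots a_m\to a_{m+1}\cdots a_{m+n}$ (reflexivity relations being implicit). $\mathcal{I}$ consists of the inclusions $\emptyset\to G$ and $G^{m+n}\to R^{m,n}$, $m,n\in\mathbb{N}$. The $\mathcal{I}$-cellular extensions form the smallest class containing $\mathcal{I}$ and closed under coproducts, pushouts and countable compositions. -}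

module Defs where

open import Level using (0ℓ)
open import Data.Nat using (ℕ; suc; _+_)
open import Data.Fin using (Fin; _↑ˡ_; _↑ʳ_)
open import Data.Empty using (⊥)
open import Data.List using (List; map; allFin)
open import Data.List.Properties using (map-∘)
open import Data.Product using (Σ; _×_; _,_)
open import Data.Sum using (_⊎_; inj₁)
open import Function using (_∘_)
open import Function.Definitions using (Injective)
open import Relation.Binary.PropositionalEquality using (_≡_; sym; cong; subst₂)

record Pres : Set₁ where
  field
    Gen   : Set
    Rel   : List Gen → List Gen → Set
    rrefl : ∀ u → Rel u u
open Pres public

record Hom (P Q : Pres) : Set where
  field
    fun  : Gen P → Gen Q
    pres : ∀ {u v} → Rel P u v → Rel Q (map fun u) (map fun v)
open Hom public

-- equality of morphisms (a morphism is determined by its map on generators)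
infix 4 _≈_
_≈_ : ∀ {P Q} → Hom P Q → Hom P Q → Set
f ≈ g = ∀ x → fun f x ≡ fun g x

infixr 9 _∘H_
_∘H_ : ∀ {P Q R} → Hom Q R → Hom P Q → Hom P R
_∘H_ {R = R} g f = record
  { fun  = fun g ∘ fun f
  ; pres = λ {u} {v} r → subst₂ (Rel R) (sym (map-∘ u)) (sym (map-∘ v)) (pres g (pres f r)) }

Mono : ∀ {P Q} → Hom P Q → Set
Mono f = Injective _≡_ _≡_ (fun f)

IsCoproduct : {I : Set} (X : I → Pres) (C : Pres) (ι : ∀ i → Hom (X i) C) → Set₁
IsCoproduct {I} X C ι =
  ∀ (Z : Pres) (c : ∀ i → Hom (X i) Z) →
    Σ (Hom C Z) λ u → (∀ i → u ∘H ι i ≈ c i)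
                    × (∀ (u' : Hom C Z) → (∀ i → u' ∘H ι i ≈ c i) → u' ≈ u)

-- the commutative square   A --f--> B
--                          |g       |k
--                          v        v
--                          C --h--> D      is a pushout
IsPushout : ∀ {A B C D} (f : Hom A B) (g : Hom A C) (h : Hom C D) (k : Hom B D) → Set₁
IsPushout {A} {B} {C} {D} f g h k =
  (k ∘H f ≈ h ∘H g) ×
  (∀ (Z : Pres) (h' : Hom C Z) (k' : Hom B Z) → k' ∘H f ≈ h' ∘H g →
     Σ (Hom D Z) λ u → (u ∘H h ≈ h') × (u ∘H k ≈ k')
                     × (∀ (u' : Hom D Z) → u' ∘H h ≈ h' → u' ∘H k ≈ k' → u' ≈ u))

IsSeqColimit : (X : ℕ → Pres) (s : ∀ n → Hom (X n) (X (suc n)))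
               (Y : Pres) (c : ∀ n → Hom (X n) Y) → Set₁
IsSeqColimit X s Y c =
  (∀ n → c (suc n) ∘H s n ≈ c n) ×
  (∀ (Z : Pres) (d : ∀ n → Hom (X n) Z) → (∀ n → d (suc n) ∘H s n ≈ d n) →
     Σ (Hom Y Z) λ u → (∀ n → u ∘H c n ≈ d n)
                     × (∀ (u' : Hom Y Z) → (∀ n → u' ∘H c n ≈ d n) → u' ≈ u))

-- presentation with generators A and no relation (besides reflexivity)
Free : Set → Pres
Free A = record { Gen = A ; Rel = _≡_ ; rrefl = λ _ → Relation.Binary.PropositionalEquality.refl }

Empty : Pres
Empty = Free ⊥

Gⁿ : ℕ → Pres
Gⁿ n = Free (Fin n)

G : Pres
G = Gⁿ 1

lhsWord : ∀ m n → List (Fin (m + n))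
lhsWord m n = map (λ i → i ↑ˡ n) (allFin m)

rhsWord : ∀ m n → List (Fin (m + n))
rhsWord m n = map (λ j → m ↑ʳ j) (allFin n)

-- R^{m,n}: generators a₁ … a_{m+n}, relation a₁⋯a_m → a_{m+1}⋯a_{m+n}
-- (plus the implicit reflexivity relations)
R : ℕ → ℕ → Pres
R m n = record
  { Gen   = Fin (m + n)
  ; Rel   = λ u v → (u ≡ v) ⊎ ((u ≡ lhsWord m n) × (v ≡ rhsWord m n))
  ; rrefl = λ _ → inj₁ Relation.Binary.PropositionalEquality.refl }

emptyToG : Hom Empty G
emptyToG = record { fun = λ () ; pres = λ r → cong (map (λ ())) r }

relIncl : ∀ m n → Hom (Gⁿ (m + n)) (R m n)
relIncl m n = record { fun = λ x → x ; pres = λ r → inj₁ (cong (map (λ x → x)) r) }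

data InI : ∀ {A B : Pres} → Hom A B → Set₁ where
  inI-empty : InI emptyToG
  inI-rel   : ∀ m n → InI (relIncl m n)

data Cell : ∀ {A B : Pres} → Hom A B → Set₁ where
  cell-I : ∀ {A B} {f : Hom A B} → InI f → Cell f
  cell-coprod : ∀ {I : Set} {A B : I → Pres} (f : ∀ i → Hom (A i) (B i)) →
    (∀ i → Cell (f i)) →
    ∀ {CA CB} (ιA : ∀ i → Hom (A i) CA) (ιB : ∀ i → Hom (B i) CB) →
    IsCoproduct A CA ιA → IsCoproduct B CB ιB →
    (h : Hom CA CB) → (∀ i → h ∘H ιA i ≈ ιB i ∘H f i) → Cell h
  cell-pushout : ∀ {A B C D} (f : Hom A B) → Cell f →
    (g : Hom A C) (h : Hom C D) (k : Hom B D) → IsPushout f g h k → Cell h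
  cell-seq : ∀ (X : ℕ → Pres) (s : ∀ n → Hom (X n) (X (suc n))) →
    (∀ n → Cell (s n)) →
    ∀ (Y : Pres) (c : ∀ n → Hom (X n) Y) → IsSeqColimit X s Y c → Cell (c 0)

LLP : ∀ {A B X Y} → Hom A B → Hom X Y → Set
LLP {A} {B} {X} {Y} f g =
  ∀ (u : Hom A X) (v : Hom B Y) → g ∘H u ≈ v ∘H f →
    Σ (Hom B X) λ d → (d ∘H f ≈ u) × (g ∘H d ≈ v)

RLP-I : ∀ {X Y} → Hom X Y → Set₁
RLP-I g = ∀ {A B} (i : Hom A B) → InI i → LLP i g

Cofibration : ∀ {A B} → Hom A B → Set₁
Cofibration f = ∀ {X Y} (g : Hom X Y) → RLP-I g → LLP f g

-- A mono f : P → Q factors as P → P' → Q, where P' has the generators of Q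
-- and the images of the relations of P.  With excluded middle the generators
-- of Q split into the image of f and the rest, so P → P' is a pushout of a
-- coproduct of copies of ∅ → G.  The map P' → Q is the identity on
-- generators; it is the pushout of the coproduct, over all relations s → t
-- of Q, of G^{|s|+|t|} → R^{|s|,|t|}.  Composites of cells are cells (as
-- colimits of sequences that are eventually identities), and every cell has
-- the LLP against maps with the RLP for 𝓘, since lifts glue along coproducts,
-- pushouts and sequential colimits.
module Submission where

open import Defs
open import Level using (0ℓ)
open import Data.Product using (_×_; Σ; _,_; proj₁; proj₂)
open import Axiom.ExcludedMiddle using (ExcludedMiddle)

open import Data.Nat using (ℕ; zero; suc; _+_)
open import Data.Fin using (Fin; zero; splitAt; _↑ˡ_; _↑ʳ_)
open import Data.Fin.Properties using (splitAt-↑ˡ; splitAt-↑ʳ)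
open import Data.Empty using (⊥; ⊥-elim)
open import Data.Unit using (tt)
open import Data.List using (List; map; allFin; length; lookup; tabulate)
open import Data.List.Properties using (map-∘; map-cong; map-tabulate; tabulate-lookup; map-id)
open import Data.Sum using (_⊎_; inj₁; inj₂; [_,_]′)
open import Function using (_∘_; id)
open import Relation.Nullary using (Dec; yes; no)
open import Relation.Nullary.Decidable using (False)
open import Relation.Binary.PropositionalEquality using (_≡_; refl; sym; trans; cong; subst₂; module ≡-Reasoning)

≡⇒Rel : ∀ Z {u v} → u ≡ v → Rel Z u v
≡⇒Rel Z refl = rrefl Z _

fromFree : ∀ {A : Set} {Z : Pres} → (A → Gen Z) → Hom (Free A) Z
fromFree {Z = Z} φ = record { fun = φ ; pres = λ e → ≡⇒Rel Z (cong (map φ) e) }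

idHom : ∀ Q → Hom Q Q
idHom Q = record { fun = id ; pres = subst₂ (Rel Q) (sym (map-id _)) (sym (map-id _)) }

coproduct-ext : ∀ {I : Set} {X : I → Pres} {C Z : Pres} {ι : ∀ i → Hom (X i) C} →
  IsCoproduct X C ι → (u₁ u₂ : Hom C Z) → (∀ i → u₁ ∘H ι i ≈ u₂ ∘H ι i) → u₁ ≈ u₂
coproduct-ext {Z = Z} {ι} cop u₁ u₂ agree with cop Z (λ i → u₂ ∘H ι i)
... | _ , _ , unique = λ x → trans (unique u₁ agree x) (sym (unique u₂ (λ _ _ → refl) x))

pushout-ext : ∀ {A B C D Z} {f : Hom A B} {g : Hom A C} {h : Hom C D} {k : Hom B D} →
  IsPushout f g h k → (u₁ u₂ : Hom D Z) → u₁ ∘H h ≈ u₂ ∘H h → u₁ ∘H k ≈ u₂ ∘H k → u₁ ≈ u₂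
pushout-ext {Z = Z} {h = h} {k} (square , univ) u₁ u₂ agreeₕ agreeₖ
  with univ Z (u₂ ∘H h) (u₂ ∘H k) (cong (fun u₂) ∘ square)
... | _ , _ , _ , unique =
  λ x → trans (unique u₁ agreeₕ agreeₖ x) (sym (unique u₂ (λ _ → refl) (λ _ → refl) x))

seqColimit-ext : ∀ {X s Y Z} {c : ∀ n → Hom (X n) Y} → IsSeqColimit X s Y c →
  (u₁ u₂ : Hom Y Z) → (∀ n → u₁ ∘H c n ≈ u₂ ∘H c n) → u₁ ≈ u₂
seqColimit-ext {Z = Z} {c} (cocone , univ) u₁ u₂ agree
  with univ Z (λ n → u₂ ∘H c n) (λ n → cong (fun u₂) ∘ cocone n)
... | _ , _ , unique = λ x → trans (unique u₁ agree x) (sym (unique u₂ (λ _ _ → refl) x))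

cell⇒llp : ∀ {A B X Y} {f : Hom A B} {p : Hom X Y} → Cell f → RLP-I p → LLP f p
cell⇒llp (cell-I i) rlp = rlp _ i
cell⇒llp {X = X} {p = p} (cell-coprod {B = B} f cf {CB = CB} ιA ιB copA copB h hι) rlp u v sq =
  d , coproduct-ext {ι = ιA} copA (d ∘H h) u d∘h≈u , coproduct-ext {ι = ιB} copB (p ∘H d) v p∘d≈v
  where
  lift : ∀ i → Σ (Hom (B i) X) λ dᵢ → (dᵢ ∘H f i ≈ u ∘H ιA i) × (p ∘H dᵢ ≈ v ∘H ιB i)
  lift i = cell⇒llp {p = p} (cf i) rlp (u ∘H ιA i) (v ∘H ιB i)
             (λ a → trans (sq (fun (ιA i) a)) (cong (fun v) (hι i a)))
  d : Hom CB X
  d = proj₁ (copB X (proj₁ ∘ lift))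
  d∘ι : ∀ i → d ∘H ιB i ≈ proj₁ (lift i)
  d∘ι = proj₁ (proj₂ (copB X (proj₁ ∘ lift)))
  d∘h≈u : ∀ i → (d ∘H h) ∘H ιA i ≈ u ∘H ιA i
  d∘h≈u i a = trans (cong (fun d) (hι i a)) (trans (d∘ι i (fun (f i) a)) (proj₁ (proj₂ (lift i)) a))
  p∘d≈v : ∀ i → (p ∘H d) ∘H ιB i ≈ v ∘H ιB i
  p∘d≈v i b = trans (cong (fun p) (d∘ι i b)) (proj₂ (proj₂ (lift i)) b)
cell⇒llp {X = X} {p = p} (cell-pushout {B = B} {D = D} f cf g h k po@(square , univ)) rlp u v sq =
  d , d∘h , pushout-ext {f = f} {g} {h} {k} po (p ∘H d) v
              (λ c → trans (cong (fun p) (d∘h c)) (sq c))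
              (λ b → trans (cong (fun p) (d∘k b)) (proj₂ (proj₂ lift) b))
  where
  lift : Σ (Hom B X) λ e → (e ∘H f ≈ u ∘H g) × (p ∘H e ≈ v ∘H k)
  lift = cell⇒llp {p = p} cf rlp (u ∘H g) (v ∘H k)
           (λ a → trans (sq (fun g a)) (cong (fun v) (sym (square a))))
  d : Hom D X
  d = proj₁ (univ X u (proj₁ lift) (proj₁ (proj₂ lift)))
  d∘h : d ∘H h ≈ u
  d∘h = proj₁ (proj₂ (univ X u (proj₁ lift) (proj₁ (proj₂ lift))))
  d∘k : d ∘H k ≈ proj₁ lift
  d∘k = proj₁ (proj₂ (proj₂ (univ X u (proj₁ lift) (proj₁ (proj₂ lift)))))
cell⇒llp {X = X'} {p = p} (cell-seq X s cs Y c colim@(cocone , univ)) rlp u v sq =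
  d , d∘c 0 , seqColimit-ext {s = s} {c = c} colim (p ∘H d) v
                (λ n x → trans (cong (fun p) (d∘c n x)) (proj₂ (ladder n) x))
  where
  ladder : ∀ n → Σ (Hom (X n) X') λ ℓ → p ∘H ℓ ≈ v ∘H c n
  step : ∀ n → Σ (Hom (X (suc n)) X') λ ℓ → (ℓ ∘H s n ≈ proj₁ (ladder n)) × (p ∘H ℓ ≈ v ∘H c (suc n))
  ladder zero = u , sq
  ladder (suc n) = proj₁ (step n) , proj₂ (proj₂ (step n))
  step n = cell⇒llp {p = p} (cs n) rlp (proj₁ (ladder n)) (v ∘H c (suc n))
             (λ x → trans (proj₂ (ladder n) x) (cong (fun v) (sym (cocone n x))))
  d : Hom Y X'
  d = proj₁ (univ X' (proj₁ ∘ ladder) (proj₁ ∘ proj₂ ∘ step))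
  d∘c : ∀ n → d ∘H c n ≈ proj₁ (ladder n)
  d∘c = proj₁ (proj₂ (univ X' (proj₁ ∘ ladder) (proj₁ ∘ proj₂ ∘ step)))

cell⇒cofibration : ∀ {A B} {f : Hom A B} → Cell f → Cofibration f
cell⇒cofibration cf p rlp = cell⇒llp {p = p} cf rlp

cell-emptyToFree : (N : Set) → Cell (fromFree {Z = Free N} λ ())
cell-emptyToFree N =
  cell-coprod (λ _ → emptyToG) (λ _ → cell-I inI-empty) (λ _ → fromFree λ ()) injection
              emptyIsCoproduct freeIsCoproduct (fromFree λ ()) (λ _ ())
  where
  injection : N → Hom G (Free N)
  injection i = fromFree λ _ → i
  emptyIsCoproduct : IsCoproduct {N} (λ _ → Empty) Empty (λ _ → fromFree λ ())
  emptyIsCoproduct Z c = fromFree (λ ()) , (λ _ ()) , (λ _ _ ())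
  freeIsCoproduct : IsCoproduct (λ _ → G) (Free N) injection
  freeIsCoproduct Z c = fromFree (λ i → fun (c i) zero) , (λ { i zero → refl }) , (λ u' e i → e i zero)

cell-id : ∀ Q → Cell (idHom Q)
cell-id Q = cell-pushout (fromFree λ ()) (cell-emptyToFree ⊥) initial (idHom Q) initial
              ((λ ()) , λ Z h' k' _ → h' , (λ _ → refl) , (λ ()) , (λ u' e _ → e))
  where
  initial : Hom Empty Q
  initial = fromFree λ ()

cell-∘ : ∀ {A B C} {f : Hom A B} {g : Hom B C} {h : Hom A C} →
  Cell f → Cell g → g ∘H f ≈ h → Cell h
cell-∘ {A} {B} {C} {f} {g} {h} cf cg gf≈h = cell-seq X s cells C c (cocone , universal)
  where
  X : ℕ → Pres
  X 0 = A
  X 1 = B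
  X (suc (suc _)) = C
  s : ∀ n → Hom (X n) (X (suc n))
  s 0 = f
  s 1 = g
  s (suc (suc _)) = idHom C
  cells : ∀ n → Cell (s n)
  cells 0 = cf
  cells 1 = cg
  cells (suc (suc _)) = cell-id C
  c : ∀ n → Hom (X n) C
  c 0 = h
  c 1 = g
  c (suc (suc _)) = idHom C
  cocone : ∀ n → c (suc n) ∘H s n ≈ c n
  cocone 0 = gf≈h
  cocone 1 _ = refl
  cocone (suc (suc _)) _ = refl
  universal : ∀ Z (d : ∀ n → Hom (X n) Z) → (∀ n → d (suc n) ∘H s n ≈ d n) →
    Σ (Hom C Z) λ u → (∀ n → u ∘H c n ≈ d n) × (∀ u' → (∀ n → u' ∘H c n ≈ d n) → u' ≈ u)
  universal Z d dcocone = d 2 , factors , λ u' e → e 2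
    where
    constant : ∀ n → d (suc (suc n)) ≈ d 2
    constant zero _ = refl
    constant (suc n) x = trans (dcocone (suc (suc n)) x) (constant n x)
    factors : ∀ n → d 2 ∘H c n ≈ d n
    factors 0 x = trans (cong (fun (d 2)) (sym (gf≈h x))) (trans (dcocone 1 (fun f x)) (dcocone 0 x))
    factors 1 = dcocone 1
    factors (suc (suc n)) x = sym (constant n x)

AdjoinGens : ∀ {P Q} → Hom P Q → Pres
AdjoinGens {P} {Q} f = record
  { Gen   = Gen Q
  ; Rel   = λ u v → (u ≡ v) ⊎ (Σ (List (Gen P)) λ a → Σ (List (Gen P)) λ b →
                                 Rel P a b × (map (fun f) a ≡ u) × (map (fun f) b ≡ v))
  ; rrefl = λ _ → inj₁ refl }

adjoin : ∀ {P Q} (f : Hom P Q) → Hom P (AdjoinGens f)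
adjoin f = record { fun = fun f ; pres = λ r → inj₂ (_ , _ , r , refl , refl) }

adjoined : ∀ {P Q} (f : Hom P Q) → Hom (AdjoinGens f) Q
adjoined {Q = Q} f = record { fun = id ; pres = pres-id }
  where
  pres-id : ∀ {u v} → Rel (AdjoinGens f) u v → Rel Q (map id u) (map id v)
  pres-id (inj₁ e) = ≡⇒Rel Q (cong _ e)
  pres-id (inj₂ (a , b , r , refl , refl)) = subst₂ (Rel Q) (sym (map-id _)) (sym (map-id _)) (pres f r)

Image : ∀ {P Q} → Hom P Q → Gen Q → Set
Image {P} f q = Σ (Gen P) λ p → fun f p ≡ q

-- A new generator is a q paired with an inhabitant of False (em {Image f q}), which
-- is ⊤ when q ∉ Image f: unlike a proof of ¬ Image f q, it is unique up to ≡.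
cell-adjoin : ExcludedMiddle 0ℓ → ∀ {P Q} (f : Hom P Q) → Mono f → Cell (adjoin f)
cell-adjoin em {P} {Q} f mono =
  cell-pushout (fromFree λ ()) (cell-emptyToFree NewGen) (fromFree λ ()) (adjoin f) newGen
    ((λ ()) , λ Z h' k' _ → let open Glue Z h' k' in
       glueHom , (λ p → choose-image p em _) , (λ { (q , t) → choose-new q em _ t })
         , (λ u' e₁ e₂ q → glue-unique u' e₁ q em _ (λ t → e₂ (q , t))))
  where
  NewGen : Set
  NewGen = Σ (Gen Q) λ q → False (em {Image f q})

  newGen : Hom (Free NewGen) (AdjoinGens f)
  newGen = fromFree proj₁

  module Glue (Z : Pres) (h' : Hom P Z) (k' : Hom (Free NewGen) Z) where
    choose : ∀ q (d : Dec (Image f q)) → (False d → Gen Z) → Gen Z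
    choose q (yes (p , _)) _   = fun h' p
    choose q (no _)        new = new tt

    choose-image : ∀ p d new → choose (fun f p) d new ≡ fun h' p
    choose-image p (yes (p' , e)) _ = cong (fun h') (mono e)
    choose-image p (no ∉)         _ = ⊥-elim (∉ (p , refl))

    choose-new : ∀ q d new (t : False d) → choose q d new ≡ new t
    choose-new q (yes _) new ()
    choose-new q (no _)  new tt = refl

    glue : Gen Q → Gen Z
    glue q = choose q em (λ t → fun k' (q , t))

    map-glue-image : ∀ a → map (fun h') a ≡ map glue (map (fun f) a)
    map-glue-image a = trans (map-cong (λ p → sym (choose-image p em _)) a) (map-∘ a)

    glue-pres : ∀ {u v} → Rel (AdjoinGens f) u v → Rel Z (map glue u) (map glue v)
    glue-pres (inj₁ e) = ≡⇒Rel Z (cong _ e)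
    glue-pres (inj₂ (a , b , r , refl , refl)) =
      subst₂ (Rel Z) (map-glue-image a) (map-glue-image b) (pres h' r)

    glueHom : Hom (AdjoinGens f) Z
    glueHom = record { fun = glue ; pres = glue-pres }

    glue-unique : ∀ (u' : Hom (AdjoinGens f) Z) → u' ∘H adjoin f ≈ h' →
      ∀ q d new → (∀ t → fun u' q ≡ new t) → fun u' q ≡ choose q d new
    glue-unique u' e₁ q (yes (p , refl)) _ _  = e₁ p
    glue-unique u' e₁ q (no _)           _ eq = eq tt

concatWord : ∀ {A : Set} (s t : List A) → Fin (length s + length t) → A
concatWord s t i = [ lookup s , lookup t ]′ (splitAt (length s) i)

map-concatWord-lhs : ∀ {A : Set} (s t : List A) →
  map (concatWord s t) (lhsWord (length s) (length t)) ≡ s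
map-concatWord-lhs s t = begin
  map (concatWord s t) (map (_↑ˡ length t) (allFin (length s)))
    ≡⟨ map-∘ (allFin (length s)) ⟨
  map (concatWord s t ∘ (_↑ˡ length t)) (allFin (length s))
    ≡⟨ map-cong (λ i → cong [ lookup s , lookup t ]′ (splitAt-↑ˡ (length s) i (length t))) _ ⟩
  map (lookup s) (allFin (length s))
    ≡⟨ map-tabulate id (lookup s) ⟩
  tabulate (lookup s)
    ≡⟨ tabulate-lookup s ⟩
  s ∎
  where open ≡-Reasoning

map-concatWord-rhs : ∀ {A : Set} (s t : List A) →
  map (concatWord s t) (rhsWord (length s) (length t)) ≡ t
map-concatWord-rhs s t = begin
  map (concatWord s t) (map (length s ↑ʳ_) (allFin (length t)))
    ≡⟨ map-∘ (allFin (length t)) ⟨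
  map (concatWord s t ∘ (length s ↑ʳ_)) (allFin (length t))
    ≡⟨ map-cong (λ i → cong [ lookup s , lookup t ]′ (splitAt-↑ʳ (length s) (length t) i)) _ ⟩
  map (lookup t) (allFin (length t))
    ≡⟨ map-tabulate id (lookup t) ⟩
  tabulate (lookup t)
    ≡⟨ tabulate-lookup t ⟩
  t ∎
  where open ≡-Reasoning

relToHom : ∀ Z {s t} → Rel Z s t → Hom (R (length s) (length t)) Z
relToHom Z {s} {t} r = record { fun = concatWord s t ; pres = pres-R }
  where
  pres-R : ∀ {u v} → Rel (R (length s) (length t)) u v →
    Rel Z (map (concatWord s t) u) (map (concatWord s t) v)
  pres-R (inj₁ e) = ≡⇒Rel Z (cong _ e)
  pres-R (inj₂ (refl , refl)) =
    subst₂ (Rel Z) (sym (map-concatWord-lhs s t)) (sym (map-concatWord-rhs s t)) r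

homToRel : ∀ {A : Set} Z (ψ : A → Gen Z) {s t : List A} (φ : Hom (R (length s) (length t)) Z) →
  (∀ i → fun φ i ≡ ψ (concatWord s t i)) → Rel Z (map ψ s) (map ψ t)
homToRel Z ψ {s} {t} φ φ≈ψ = subst₂ (Rel Z) (map-φ (map-concatWord-lhs s t)) (map-φ (map-concatWord-rhs s t))
                               (pres φ (inj₂ (refl , refl)))
  where
  map-φ : ∀ {w u} → map (concatWord s t) w ≡ u → map (fun φ) w ≡ map ψ u
  map-φ {w} refl = trans (map-cong φ≈ψ w) (map-∘ w)

module RelationCoproducts {J : Set} (m n : J → ℕ) where

  Slot : Set
  Slot = Σ J λ j → Fin (m j + n j)

  ∐R : Pres
  ∐R = record
    { Gen   = Slot
    ; Rel   = λ u v → (u ≡ v) ⊎ (Σ J λ j → (u ≡ map (j ,_) (lhsWord (m j) (n j)))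
                                         × (v ≡ map (j ,_) (rhsWord (m j) (n j))))
    ; rrefl = λ _ → inj₁ refl }

  ιG : ∀ j → Hom (Gⁿ (m j + n j)) (Free Slot)
  ιG j = fromFree (j ,_)

  ιR : ∀ j → Hom (R (m j) (n j)) ∐R
  ιR j = record { fun = j ,_ ; pres = pres-ι }
    where
    pres-ι : ∀ {u v} → Rel (R (m j) (n j)) u v → Rel ∐R (map (j ,_) u) (map (j ,_) v)
    pres-ι (inj₁ e)          = inj₁ (cong _ e)
    pres-ι (inj₂ (e₁ , e₂)) = inj₂ (j , cong (map (j ,_)) e₁ , cong (map (j ,_)) e₂)

  ∐G-isCoproduct : IsCoproduct (λ j → Gⁿ (m j + n j)) (Free Slot) ιG
  ∐G-isCoproduct Z c = fromFree (λ (j , i) → fun (c j) i) , (λ _ _ → refl) , (λ u' e (j , i) → e j i)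

  ∐R-isCoproduct : IsCoproduct (λ j → R (m j) (n j)) ∐R ιR
  ∐R-isCoproduct Z c = record { fun = copair ; pres = pres-copair } , (λ _ _ → refl) ,
                       (λ u' e (j , i) → e j i)
    where
    copair : Slot → Gen Z
    copair (j , i) = fun (c j) i
    pres-copair : ∀ {u v} → Rel ∐R u v → Rel Z (map copair u) (map copair v)
    pres-copair (inj₁ e) = ≡⇒Rel Z (cong _ e)
    pres-copair (inj₂ (j , refl , refl)) = subst₂ (Rel Z) (map-∘ _) (map-∘ _) (pres (c j) (inj₂ (refl , refl)))

  ∐relIncl : Hom (Free Slot) ∐R
  ∐relIncl = record { fun = id ; pres = λ e → inj₁ (cong (map id) e) }

  cell-∐relIncl : Cell ∐relIncl
  cell-∐relIncl = cell-coprod (λ j → relIncl (m j) (n j)) (λ j → cell-I (inI-rel (m j) (n j)))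
                    ιG ιR ∐G-isCoproduct ∐R-isCoproduct ∐relIncl (λ _ _ → refl)

cell-invertibleOnGens : ∀ {P Q} (h : Hom P Q) (σ : Gen Q → Gen P) →
  (∀ p → σ (fun h p) ≡ p) → (∀ q → fun h (σ q) ≡ q) → Cell h
cell-invertibleOnGens {P} {Q} h σ σ∘h h∘σ =
  cell-pushout ∐relIncl cell-∐relIncl attach h relations
    ((λ x → sym (h∘σ (word x))) , λ Z h' k' comm →
       glue Z h' k' comm , (λ p → cong (fun h') (σ∘h p)) , (λ x → sym (comm x))
         , (λ u' e₁ _ q → trans (cong (fun u') (sym (h∘σ q))) (e₁ (σ q))))
  where
  RelQ : Set
  RelQ = Σ (List (Gen Q) × List (Gen Q)) λ (s , t) → Rel Q s t

  lhsLength rhsLength : RelQ → ℕ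
  lhsLength ((s , _) , _) = length s
  rhsLength ((_ , t) , _) = length t

  open RelationCoproducts lhsLength rhsLength

  word : Slot → Gen Q
  word (((s , t) , _) , i) = concatWord s t i

  attach : Hom (Free Slot) P
  attach = fromFree (σ ∘ word)

  relations : Hom ∐R Q
  relations = proj₁ (∐R-isCoproduct Q (λ (_ , r) → relToHom Q r))

  glue : ∀ Z (h' : Hom P Z) (k' : Hom ∐R Z) → k' ∘H ∐relIncl ≈ h' ∘H attach → Hom Q Z
  glue Z h' k' comm = record
    { fun  = fun h' ∘ σ
    ; pres = λ r → homToRel Z (fun h' ∘ σ) (k' ∘H ιR (_ , r)) (λ i → comm ((_ , r) , i)) }

mono⇒cell : ExcludedMiddle 0ℓ → ∀ {P Q} (f : Hom P Q) → Mono f → Cell f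
mono⇒cell em f mono =
  cell-∘ (cell-adjoin em f mono) (cell-invertibleOnGens (adjoined f) id (λ _ → refl) (λ _ → refl))
         (λ _ → refl)

mainTheorem11 : ExcludedMiddle 0ℓ →
    ∀ {P Q : Pres} (f : Hom P Q) → Mono f → Cofibration f × Cell f
mainTheorem11 em f mono = cell⇒cofibration cell , cell
  where
  cell : Cell f
  cell = mono⇒cell em f mono
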